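{- Let $k$ be any positive integer, and let $\alpha=p_\alpha/q_\alpha$ and $\beta=p_\beta/q_\beta$ be rational constants (with $p_\alpha,q_\alpha,p_\beta,q_\beta$ positive integers) such that $0<\alpha<\beta<1-\alpha<1$. Put $a_1=q_\alpha^{k-1}$, $b_1=q_\beta^{k-1}$, and for $i=1,\ldots,k$ let $a_i=a_1(2-\alpha^{i-1})$ and $b_i=b_1\beta^{i-1}$. Then $$f(x,y)=\sum_{i=1}^k x^{a_i}y^{b_i}$$ is an irreducible polynomial (in particular all $a_i$ and $b_i$ are positive integers).
   Context: Big-oh in two variables: for real functions $f(n_1,n_2)$ and $g(n_1,n_2)$ of nonnegative arguments, $f(n_1,n_2)=O(g(n_1,n_2))$ means there exist positive constants $c$, $n_{1,0}$, $n_{2,0}$ such that $f(n_1,n_2)\le c\,g(n_1,n_2)$ for all $n_1,n_2\ge 0$ satisfying $n_1\ge n_{1,0}$ or $n_2\ge n_{2,0}$. A term is a product of single-variable functions (here each $x^{a_i}y^{b_i}$). Given terms $T_1,\ldots,T_k$ and $S=T_1+\cdots+T_k$, the term $T_i$ is independent with respect to $S$ if $T_i=O(S-T_i)$ does not hold; $S$ is irreducible if every $T_i$ is independent with respect to $S$. -}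

module Defs where

open import Data.Nat using (ℕ; zero; suc)
open import Data.Fin using (Fin; zero; suc; toℕ)
open import Data.Integer using (+_)
open import Data.Rational using (ℚ; 0ℚ; 1ℚ; _+_; _-_; _*_; _≤_; _<_; _/_)
open import Data.Product using (Σ; _×_)
open import Data.Sum using (_⊎_)
open import Relation.Nullary using (¬_)

infixr 8 _^_
_^_ : ℚ → ℕ → ℚ
x ^ zero  = 1ℚ
x ^ suc n = x * (x ^ n)

ι : ℕ → ℚ
ι n = + n / 1

Σᶠ : (k : ℕ) → (Fin k → ℚ) → ℚ
Σᶠ zero    f = 0ℚ
Σᶠ (suc k) f = f zero + Σᶠ k (λ i → f (suc i))

Fun₂ : Set
Fun₂ = ℚ → ℚ → ℚ

BigO : Fun₂ → Fun₂ → Set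
BigO f g =
  Σ ℚ λ c → Σ ℚ λ n₁₀ → Σ ℚ λ n₂₀ →
    (0ℚ < c) × (0ℚ < n₁₀) × (0ℚ < n₂₀) ×
    (∀ n₁ n₂ → 0ℚ ≤ n₁ → 0ℚ ≤ n₂ → (n₁₀ ≤ n₁ ⊎ n₂₀ ≤ n₂) →
       f n₁ n₂ ≤ c * g n₁ n₂)

term : ℕ → ℕ → Fun₂
term a b x y = (x ^ a) * (y ^ b)

sumTerms : (k : ℕ) → (Fin k → ℕ) → (Fin k → ℕ) → Fun₂
sumTerms k A B x y = Σᶠ k (λ i → term (A i) (B i) x y)

Independent : (k : ℕ) → (Fin k → ℕ) → (Fin k → ℕ) → Fin k → Set
Independent k A B i =
  ¬ BigO (term (A i) (B i)) (λ x y → sumTerms k A B x y - term (A i) (B i) x y)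

Irreducible : (k : ℕ) → (Fin k → ℕ) → (Fin k → ℕ) → Set
Irreducible k A B = ∀ i → Independent k A B i

-- Proof idea (a Newton-polygon argument).  Index the terms by j = 0, …, n with
-- n = k − 1.  For each i we exhibit natural weights P > 0, Q such that the weighted
-- degree P·a_j + Q·b_j is maximised at j = i only.  Then on the curve x = t^P, y = t^Q
-- the i-th term is t^(e+1) while the k − 1 others are at most t^e each, so no constant
-- c can give T_i ≤ c (S − T_i) for all large x: T_i is independent.
--
-- Along j, A rises and B falls by explicit gaps; for the
-- weights P = e_β (q_α + p_α) B i, Q = e_α (q_β + p_β) D i the weighted degree rises
-- before i and falls after i (this uses only p_α q_β < p_β q_α, i.e. α < β), so i is
-- its unique maximiser.
module Submission where

module Natural where
  open import Data.Nat
  open import Data.Nat.Properties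
  open import Data.Nat.Solver using (module +-*-Solver)
  open +-*-Solver
  open import Data.Product using (_,_)
  open import Data.Sum using (inj₁; inj₂)
  open import Data.Empty using (⊥-elim)
  open import Relation.Nullary using (yes; no)
  open import Relation.Binary.PropositionalEquality
  open import Relation.Binary.Definitions using (tri<; tri≈; tri>)

  rise : (E : ℕ → ℕ) {i : ℕ} → (∀ m → m < i → E m < E (suc m)) →
         ∀ {j} → j < i → E j < E i
  rise E {suc i} up j<1+i with m≤n⇒m<n∨m≡n (s≤s⁻¹ j<1+i)
  ... | inj₁ j<i  = <-trans (rise E (λ m m<i → up m (m<n⇒m<1+n m<i)) j<i) (up i (n<1+n i))
  ... | inj₂ refl = up i (n<1+n i)

  fall : (E : ℕ → ℕ) {i n : ℕ} → (∀ m → i ≤ m → m < n → E (suc m) < E m) →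
         ∀ {j} → i < j → j ≤ n → E j < E i
  fall E down {suc j} i<1+j j<n with m≤n⇒m<n∨m≡n (s≤s⁻¹ i<1+j)
  ... | inj₁ i<j  = <-trans (down j (<⇒≤ i<j) j<n) (fall E down i<j (<⇒≤ j<n))
  ... | inj₂ refl = down j ≤-refl j<n

  peak : (E : ℕ → ℕ) {i n : ℕ} →
         (∀ m → m < i → E m < E (suc m)) → (∀ m → i ≤ m → m < n → E (suc m) < E m) →
         ∀ j → j ≤ n → j ≢ i → E j < E i
  peak E up down j j≤n j≢i with <-cmp j _
  ... | tri< j<i _ _ = rise E up j<i
  ... | tri≈ _ j≡i _ = ⊥-elim (j≢i j≡i)
  ... | tri> _ _ i<j = fall E down i<j j≤n

  balance-< : ∀ {x y a b} → x + a ≡ y + b → b < a → x < y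
  balance-< {x} {y} eq b<a with x <? y
  ... | yes x<y = x<y
  ... | no x≮y  = ⊥-elim (<-irrefl (sym eq) (+-mono-≤-< (≮⇒≥ x≮y) b<a))

  ∸-of-sum : ∀ a b {n} → a + b ≡ n → n ∸ a ≡ b
  ∸-of-sum a b refl = m+n∸m≡n a b

  *-^ : ∀ a b u → (a * b) ^ u ≡ a ^ u * b ^ u
  *-^ a b zero    = refl
  *-^ a b (suc u) = begin
      a * b * (a * b) ^ u     ≡⟨ cong (a * b *_) (*-^ a b u) ⟩
      a * b * (a ^ u * b ^ u) ≡⟨ solve 4 (λ a b x y → a :* b :* (x :* y) := a :* x :* (b :* y)) refl a b (a ^ u) (b ^ u) ⟩
      a * a ^ u * (b * b ^ u) ∎
    where open ≡-Reasoning

  pow-gap : ∀ u {c c' a b a' b'} .{{_ : NonZero a'}} .{{_ : NonZero b'}} →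
            c < c' → a * b ≤ a' * b' → c * (a ^ u * b ^ u) < c' * (a' ^ u * b' ^ u)
  pow-gap u {c} {c'} {a} {b} {a'} {b'} c<c' ab≤a'b' = begin-strict
      c * (a ^ u * b ^ u)    ≡⟨ cong (c *_) (*-^ a b u) ⟨
      c * (a * b) ^ u        ≤⟨ *-monoʳ-≤ c (^-monoˡ-≤ u ab≤a'b') ⟩
      c * (a' * b') ^ u      <⟨ *-monoˡ-< ((a' * b') ^ u) {{m^n≢0 (a' * b') u {{m*n≢0 a' b'}}}} c<c' ⟩
      c' * (a' * b') ^ u     ≡⟨ cong (c' *_) (*-^ a' b' u) ⟩
      c' * (a' ^ u * b' ^ u) ∎
    where open ≤-Reasoning

  geometric-step : ∀ p e m r →
    p ^ m * (p + e) ^ suc r ≡ p ^ suc m * (p + e) ^ r + p ^ m * (p + e) ^ r * e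
  geometric-step p e m r =
    solve 4 (λ x y p e → x :* ((p :+ e) :* y) := p :* x :* y :+ x :* y :* e) refl (p ^ m) ((p + e) ^ r) p e

  -- The exponent pairs of the theorem for k = n + 1 (indices j = 0, …, n), with
  -- α = pa/qa < β = pb/qb in (0, 1): writing D j = qa^n α^j and B j = qb^n β^j,
  -- the x-exponent is A j = qa^n (2 − α^j) = 2 qa^n − D j and the y-exponent is B j.
  module Exponents (pa qa pb qb : ℕ) (0<pa : 0 < pa) (pa<qa : pa < qa) (0<pb : 0 < pb) (pb<qb : pb < qb)
                   (cross : pa * qb < pb * qa) (n : ℕ) where

    ea eb : ℕ
    ea = qa ∸ pa
    eb = qb ∸ pb

    qa>0 : 0 < qa
    qa>0 = <-trans 0<pa pa<qa
    qb>0 : 0 < qb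
    qb>0 = <-trans 0<pb pb<qb
    ea>0 : 0 < ea
    ea>0 = m<n⇒0<n∸m pa<qa
    eb>0 : 0 < eb
    eb>0 = m<n⇒0<n∸m pb<qb

    private instance
      pa≢0 : NonZero pa
      pa≢0 = >-nonZero 0<pa
      pb≢0 : NonZero pb
      pb≢0 = >-nonZero 0<pb
      qa≢0 : NonZero qa
      qa≢0 = >-nonZero qa>0
      qb≢0 : NonZero qb
      qb≢0 = >-nonZero qb>0

    qa≡pa+ea : qa ≡ pa + ea
    qa≡pa+ea = sym (m+[n∸m]≡n (<⇒≤ pa<qa))

    qb≡pb+eb : qb ≡ pb + eb
    qb≡pb+eb = sym (m+[n∸m]≡n (<⇒≤ pb<qb))

    mix : ℕ → ℕ → ℕ → ℕ
    mix p q j = p ^ j * q ^ (n ∸ j)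

    mix-gap : ∀ p {q} e {m r} → q ≡ p + e → suc m + r ≡ n →
              mix p q m ≡ mix p q (suc m) + p ^ m * q ^ r * e
    mix-gap p e {m} {r} refl eq
      rewrite ∸-of-sum m (suc r) (trans (+-suc m r) eq) | ∸-of-sum (suc m) r eq = geometric-step p e m r

    D B A : ℕ → ℕ
    D = mix pa qa
    B = mix pb qb
    A j = 2 * qa ^ n ∸ D j

    -- α^j ≤ 1, so D j ≤ qa^n and the truncated subtraction in A is exact.
    D≤qa^n : ∀ {j} → j ≤ n → D j ≤ qa ^ n
    D≤qa^n {j} j≤n = begin
        pa ^ j * qa ^ (n ∸ j) ≤⟨ *-monoˡ-≤ (qa ^ (n ∸ j)) (^-monoˡ-≤ j (<⇒≤ pa<qa)) ⟩
        qa ^ j * qa ^ (n ∸ j) ≡⟨ ^-distribˡ-+-* qa j (n ∸ j) ⟨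
        qa ^ (j + (n ∸ j))    ≡⟨ cong (qa ^_) (m+[n∸m]≡n j≤n) ⟩
        qa ^ n                ∎
      where open ≤-Reasoning

    A+D : ∀ {j} → j ≤ n → A j + D j ≡ 2 * qa ^ n
    A+D j≤n = m∸n+n≡m (≤-trans (D≤qa^n j≤n) (m≤m+n (qa ^ n) (qa ^ n + 0)))

    A-pos : ∀ {j} → j ≤ n → 0 < A j
    A-pos {j} j≤n = begin-strict
        0                      <⟨ m^n>0 qa n ⟩
        qa ^ n                 ≡⟨ trans (m+n∸m≡n (qa ^ n) (qa ^ n + 0)) (+-identityʳ (qa ^ n)) ⟨
        2 * qa ^ n ∸ qa ^ n    ≤⟨ ∸-monoʳ-≤ (2 * qa ^ n) (D≤qa^n j≤n) ⟩
        A j                    ∎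
      where open ≤-Reasoning

    B-pos : ∀ j → 0 < B j
    B-pos j = *-mono-< (m^n>0 pb j) (m^n>0 qb (n ∸ j))

    -- Consecutive differences: A rises by gapD m r and B falls by gapB m r at m → m+1.
    gapD gapB : ℕ → ℕ → ℕ
    gapD m r = pa ^ m * qa ^ r * ea
    gapB m r = pb ^ m * qb ^ r * eb

    B-gap : ∀ {m r} → suc m + r ≡ n → B m ≡ B (suc m) + gapB m r
    B-gap = mix-gap pb eb qb≡pb+eb

    A-gap : ∀ {m r} → suc m + r ≡ n → A (suc m) ≡ A m + gapD m r
    A-gap {m} {r} eq = +-cancelʳ-≡ (D (suc m)) _ _ (begin
        A (suc m) + D (suc m)        ≡⟨ A+D 1+m≤n ⟩
        2 * qa ^ n                   ≡⟨ A+D (<⇒≤ 1+m≤n) ⟨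
        A m + D m                    ≡⟨ cong (A m +_) (mix-gap pa ea qa≡pa+ea eq) ⟩
        A m + (D (suc m) + gapD m r) ≡⟨ solve 3 (λ a d g → a :+ (d :+ g) := a :+ g :+ d) refl (A m) (D (suc m)) (gapD m r) ⟩
        A m + gapD m r + D (suc m)   ∎)
      where
        open ≡-Reasoning
        1+m≤n : suc m ≤ n
        1+m≤n = subst (suc m ≤_) eq (m≤m+n (suc m) r)

    -- The weighting that singles out the i-th pair.  Its slope P/Q lies strictly
    -- between the slopes gapB/gapD of the edges before and after index i.
    weightP weightQ : ℕ → ℕ → ℕ
    weightP I W = eb * (qa + pa) * (pb ^ I * qb ^ W)
    weightQ I W = ea * (qb + pb) * (pa ^ I * qa ^ W)

    -- common positive factor of both sides in the slope comparisons
    scale : ℕ → ℕ → ℕ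
    scale m w = ea * eb * (pa ^ m * pb ^ m) * (qa ^ w * qb ^ w)

    scale-pos : ∀ m w → 0 < scale m w
    scale-pos m w = *-mono-< (*-mono-< (*-mono-< ea>0 eb>0) (*-mono-< (m^n>0 pa m) (m^n>0 pb m)))
                             (*-mono-< (m^n>0 qa w) (m^n>0 qb w))

    -- Before i the weighted degree rises: the gain in A outweighs the loss in B.
    slope-below : ∀ m u w → weightQ (suc m + u) w * gapB m (u + w) < weightP (suc m + u) w * gapD m (u + w)
    slope-below m u w
      rewrite ^-distribˡ-+-* pa m u | ^-distribˡ-+-* pb m u
            | ^-distribˡ-+-* qb u w | ^-distribˡ-+-* qa u w = begin-strict
        ea * (qb + pb) * (pa * (pa ^ m * pa ^ u) * qa ^ w) * (pb ^ m * (qb ^ u * qb ^ w) * eb)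
          ≡⟨ solve 14 (λ ea eb pa pb qa qb am bm aw bw au bu cu du →
                ea :* (qb :+ pb) :* (pa :* (am :* au) :* aw) :* (bm :* (du :* bw) :* eb)
                := (ea :* eb :* (am :* bm) :* (aw :* bw)) :* ((qb :+ pb) :* pa :* (au :* du)))
                refl ea eb pa pb qa qb (pa ^ m) (pb ^ m) (qa ^ w) (qb ^ w) (pa ^ u) (pb ^ u) (qa ^ u) (qb ^ u) ⟩
        scale m w * ((qb + pb) * pa * (pa ^ u * qb ^ u))
          <⟨ *-monoʳ-< (scale m w) {{>-nonZero (scale-pos m w)}} (pow-gap u core (<⇒≤ cross)) ⟩
        scale m w * ((qa + pa) * pb * (pb ^ u * qa ^ u))
          ≡⟨ solve 14 (λ ea eb pa pb qa qb am bm aw bw au bu cu du →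
                (ea :* eb :* (am :* bm) :* (aw :* bw)) :* ((qa :+ pa) :* pb :* (bu :* cu))
                := eb :* (qa :+ pa) :* (pb :* (bm :* bu) :* bw) :* (am :* (cu :* aw) :* ea))
                refl ea eb pa pb qa qb (pa ^ m) (pb ^ m) (qa ^ w) (qb ^ w) (pa ^ u) (pb ^ u) (qa ^ u) (qb ^ u) ⟩
        eb * (qa + pa) * (pb * (pb ^ m * pb ^ u) * qb ^ w) * (pa ^ m * (qa ^ u * qa ^ w) * ea) ∎
      where
        open ≤-Reasoning
        core : (qb + pb) * pa < (qa + pa) * pb
        core = begin-strict
          (qb + pb) * pa    ≡⟨ solve 3 (λ qb pb pa → (qb :+ pb) :* pa := pa :* qb :+ pa :* pb) refl qb pb pa ⟩
          pa * qb + pa * pb <⟨ +-monoˡ-< (pa * pb) cross ⟩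
          pb * qa + pa * pb ≡⟨ solve 3 (λ qa pa pb → pb :* qa :+ pa :* pb := (qa :+ pa) :* pb) refl qa pa pb ⟩
          (qa + pa) * pb    ∎

    -- From i on the weighted degree falls: the loss in B outweighs the gain in A.
    slope-above : ∀ i v r → weightP i (suc v + r) * gapD (i + v) r < weightQ i (suc v + r) * gapB (i + v) r
    slope-above i v r
      rewrite ^-distribˡ-+-* pa i v | ^-distribˡ-+-* pb i v
            | ^-distribˡ-+-* qb v r | ^-distribˡ-+-* qa v r = begin-strict
        eb * (qa + pa) * (pb ^ i * (qb * (qb ^ v * qb ^ r))) * (pa ^ i * pa ^ v * qa ^ r * ea)
          ≡⟨ solve 14 (λ ea eb pa pb qa qb ai bi ar br av bv cv dv →
                eb :* (qa :+ pa) :* (bi :* (qb :* (dv :* br))) :* (ai :* av :* ar :* ea)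
                := (ea :* eb :* (ai :* bi) :* (ar :* br)) :* ((qa :+ pa) :* qb :* (av :* dv)))
                refl ea eb pa pb qa qb (pa ^ i) (pb ^ i) (qa ^ r) (qb ^ r) (pa ^ v) (pb ^ v) (qa ^ v) (qb ^ v) ⟩
        scale i r * ((qa + pa) * qb * (pa ^ v * qb ^ v))
          <⟨ *-monoʳ-< (scale i r) {{>-nonZero (scale-pos i r)}} (pow-gap v core (<⇒≤ cross)) ⟩
        scale i r * ((qb + pb) * qa * (pb ^ v * qa ^ v))
          ≡⟨ solve 14 (λ ea eb pa pb qa qb ai bi ar br av bv cv dv →
                (ea :* eb :* (ai :* bi) :* (ar :* br)) :* ((qb :+ pb) :* qa :* (bv :* cv))
                := ea :* (qb :+ pb) :* (ai :* (qa :* (cv :* ar))) :* (bi :* bv :* br :* eb))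
                refl ea eb pa pb qa qb (pa ^ i) (pb ^ i) (qa ^ r) (qb ^ r) (pa ^ v) (pb ^ v) (qa ^ v) (qb ^ v) ⟩
        ea * (qb + pb) * (pa ^ i * (qa * (qa ^ v * qa ^ r))) * (pb ^ i * pb ^ v * qb ^ r * eb) ∎
      where
        open ≤-Reasoning
        core : (qa + pa) * qb < (qb + pb) * qa
        core = begin-strict
          (qa + pa) * qb    ≡⟨ solve 3 (λ qa pa qb → (qa :+ pa) :* qb := qa :* qb :+ pa :* qb) refl qa pa qb ⟩
          qa * qb + pa * qb <⟨ +-monoʳ-< (qa * qb) cross ⟩
          qa * qb + pb * qa ≡⟨ solve 3 (λ qa qb pb → qa :* qb :+ pb :* qa := (qb :+ pb) :* qa) refl qa qb pb ⟩
          (qb + pb) * qa    ∎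

    P Q : ℕ → ℕ
    P i = weightP i (n ∸ i)
    Q i = weightQ i (n ∸ i)

    P-pos : ∀ i → 0 < P i
    P-pos i = *-mono-< (*-mono-< eb>0 (<-≤-trans qa>0 (m≤m+n qa pa))) (*-mono-< (m^n>0 pb i) (m^n>0 qb (n ∸ i)))

    deg : ℕ → ℕ → ℕ
    deg i j = P i * A j + Q i * B j

    deg-step : ∀ i {m r} → suc m + r ≡ n →
               deg i m + P i * gapD m r ≡ deg i (suc m) + Q i * gapB m r
    deg-step i {m} {r} eq = begin
        P i * A m + Q i * B m + P i * gapD m r
          ≡⟨ cong (λ b → P i * A m + Q i * b + P i * gapD m r) (B-gap eq) ⟩
        P i * A m + Q i * (B (suc m) + gapB m r) + P i * gapD m r
          ≡⟨ solve 6 (λ p q a b g h → p :* a :+ q :* (b :+ h) :+ p :* g := p :* (a :+ g) :+ q :* b :+ q :* h)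
               refl (P i) (Q i) (A m) (B (suc m)) (gapD m r) (gapB m r) ⟩
        P i * (A m + gapD m r) + Q i * B (suc m) + Q i * gapB m r
          ≡⟨ cong (λ a → P i * a + Q i * B (suc m) + Q i * gapB m r) (A-gap eq) ⟨
        P i * A (suc m) + Q i * B (suc m) + Q i * gapB m r ∎
      where open ≡-Reasoning

    deg-rises : ∀ {i} → i ≤ n → ∀ m → m < i → deg i m < deg i (suc m)
    deg-rises i≤n m m<i with m≤n⇒∃[o]m+o≡n m<i
    ... | u , refl with m≤n⇒∃[o]m+o≡n i≤n
    ...   | w , i+w≡n = balance-< (deg-step (suc m + u) (trans (sym (+-assoc (suc m) u w)) i+w≡n))
        (subst (λ W → weightQ (suc m + u) W * gapB m (u + w) < weightP (suc m + u) W * gapD m (u + w))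
               (sym (∸-of-sum (suc m + u) w i+w≡n)) (slope-below m u w))

    deg-falls : ∀ {i} m → i ≤ m → m < n → deg i (suc m) < deg i m
    deg-falls {i} m i≤m m<n with m≤n⇒∃[o]m+o≡n i≤m
    ... | v , refl with m≤n⇒∃[o]m+o≡n m<n
    ...   | r , eq = balance-< (sym (deg-step i eq))
        (subst (λ W → weightP i W * gapD (i + v) r < weightQ i W * gapB (i + v) r)
               (sym (∸-of-sum i (suc v + r) (trans (+-suc i (v + r)) (trans (cong suc (sym (+-assoc i v r))) eq))))
               (slope-above i v r))

    deg-peak : ∀ {i} → i ≤ n → ∀ j → j ≤ n → j ≢ i → deg i j < deg i i
    deg-peak {i} i≤n = peak (deg i) (deg-rises i≤n) (deg-falls {i})

    deg-pos : ∀ {i} → i ≤ n → 0 < deg i i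
    deg-pos {i} i≤n = <-≤-trans (A-pos i≤n) (≤-trans (m≤n*m (A i) (P i) {{>-nonZero (P-pos i)}}) (m≤m+n (P i * A i) (Q i * B i)))

module Rational where
  open import Defs
  open import Data.Nat.Base using (ℕ; zero; suc)
  import Data.Nat as ℕ
  import Data.Nat.Properties as ℕₚ
  open import Data.Integer.Base using (+_)
  import Data.Integer as ℤ
  import Data.Integer.Properties as ℤₚ
  import Data.Nat.Coprimality as Coprime
  open import Data.Rational
  open import Data.Rational.Properties
  import Data.Rational.Unnormalised as ℚᵘ
  import Data.Rational.Unnormalised.Properties as ℚᵘₚ
  open import Data.Rational.Solver using (module +-*-Solver)
  open +-*-Solver
  open import Data.Fin.Base using (Fin) renaming (zero to fzero; suc to fsuc)
  import Data.Fin.Properties as Finₚ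
  open import Data.Product using (_,_)
  open import Data.Sum using (inj₁; inj₂)
  open import Data.Empty using (⊥-elim)
  open import Relation.Nullary using (yes; no)
  open import Relation.Binary.PropositionalEquality
  open import Function.Base using (_∘_)

  ι-mkℚ : ∀ n → ι n ≡ mkℚ (+ n) 0 (Coprime.sym (Coprime.1-coprimeTo n))
  ι-mkℚ n = normalize-coprime (Coprime.sym (Coprime.1-coprimeTo n))

  ι-+ : ∀ m n → ι (m ℕ.+ n) ≡ ι m + ι n
  ι-+ m n rewrite ι-mkℚ m | ι-mkℚ n =
    /-cong (sym (trans (cong₂ ℤ._+_ (ℤₚ.*-identityʳ (+ m)) (ℤₚ.*-identityʳ (+ n))) (sym (ℤₚ.pos-+ m n)))) refl

  ι-* : ∀ m n → ι (m ℕ.* n) ≡ ι m * ι n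
  ι-* m n rewrite ι-mkℚ m | ι-mkℚ n = /-cong (ℤₚ.pos-* m n) refl

  ι-≤ : ∀ {m n} → m ℕ.≤ n → ι m ≤ ι n
  ι-≤ {m} {n} m≤n rewrite ι-mkℚ m | ι-mkℚ n =
    *≤* (subst₂ ℤ._≤_ (sym (ℤₚ.*-identityʳ (+ m))) (sym (ℤₚ.*-identityʳ (+ n))) (ℤ.+≤+ m≤n))

  ι-< : ∀ {m n} → m ℕ.< n → ι m < ι n
  ι-< {m} {n} m<n rewrite ι-mkℚ m | ι-mkℚ n =
    *<* (subst₂ ℤ._<_ (sym (ℤₚ.*-identityʳ (+ m))) (sym (ℤₚ.*-identityʳ (+ n))) (ℤ.+<+ m<n))

  ι-<⁻¹ : ∀ {m n} → ι m < ι n → m ℕ.< n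
  ι-<⁻¹ {m} {n} ιm<ιn with m ℕ.<? n
  ... | yes m<n = m<n
  ... | no m≮n  = ⊥-elim (<-irrefl refl (<-≤-trans ιm<ιn (ι-≤ (ℕₚ.≮⇒≥ m≮n))))

  /-*-cancel : ∀ p q .{{_ : ℕ.NonZero q}} → (+ p / q) * ι q ≡ ι p
  /-*-cancel p (suc q) = toℚᵘ-injective (begin
      toℚᵘ ((+ p / suc q) * ι (suc q))
        ≈⟨ toℚᵘ-homo-* (+ p / suc q) (ι (suc q)) ⟩
      toℚᵘ (+ p / suc q) ℚᵘ.* toℚᵘ (ι (suc q))
        ≈⟨ ℚᵘₚ.*-cong (toℚᵘ-fromℚᵘ (ℚᵘ.mkℚᵘ (+ p) q)) (toℚᵘ-fromℚᵘ (ℚᵘ.mkℚᵘ (+ suc q) 0)) ⟩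
      ℚᵘ.mkℚᵘ (+ p) q ℚᵘ.* ℚᵘ.mkℚᵘ (+ suc q) 0
        ≈⟨ ℚᵘ.*≡* (trans (ℤₚ.*-identityʳ _) (cong (λ d → + p ℤ.* + d) (sym (ℕₚ.*-identityʳ (suc q))))) ⟩
      ℚᵘ.mkℚᵘ (+ p) 0
        ≈⟨ ℚᵘₚ.≃-sym (toℚᵘ-fromℚᵘ (ℚᵘ.mkℚᵘ (+ p) 0)) ⟩
      toℚᵘ (ι p) ∎)
    where open ℚᵘₚ.≃-Reasoning

  cross-multiply : ∀ p q p' q' .{{_ : ℕ.NonZero q}} .{{_ : ℕ.NonZero q'}} →
                   + p / q < + p' / q' → p ℕ.* q' ℕ.< p' ℕ.* q
  cross-multiply p q p' q' lt = ι-<⁻¹ (subst₂ _<_ lhs rhs (*-monoˡ-<-pos (ι q * ι q') {{positive qq'>0}} lt))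
    where
      qq'>0 : 0ℚ < ι q * ι q'
      qq'>0 = subst (0ℚ <_) (ι-* q q') (ι-< {0} (ℕₚ.*-mono-< (ℕ.>-nonZero⁻¹ q) (ℕ.>-nonZero⁻¹ q')))
      lhs : (+ p / q) * (ι q * ι q') ≡ ι (p ℕ.* q')
      lhs = begin
        (+ p / q) * (ι q * ι q') ≡⟨ *-assoc (+ p / q) (ι q) (ι q') ⟨
        (+ p / q) * ι q * ι q'   ≡⟨ cong (_* ι q') (/-*-cancel p q) ⟩
        ι p * ι q'               ≡⟨ ι-* p q' ⟨
        ι (p ℕ.* q')             ∎
        where open ≡-Reasoning
      rhs : (+ p' / q') * (ι q * ι q') ≡ ι (p' ℕ.* q)
      rhs = begin
        (+ p' / q') * (ι q * ι q') ≡⟨ cong ((+ p' / q') *_) (*-comm (ι q) (ι q')) ⟩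
        (+ p' / q') * (ι q' * ι q) ≡⟨ *-assoc (+ p' / q') (ι q') (ι q) ⟨
        (+ p' / q') * ι q' * ι q   ≡⟨ cong (_* ι q) (/-*-cancel p' q') ⟩
        ι p' * ι q                 ≡⟨ ι-* p' q ⟨
        ι (p' ℕ.* q)               ∎
        where open ≡-Reasoning

  /<1⇒< : ∀ p q .{{_ : ℕ.NonZero q}} → + p / q < 1ℚ → p ℕ.< q
  /<1⇒< p q lt = subst₂ ℕ._<_ (ℕₚ.*-identityʳ p) (ℕₚ.*-identityˡ q) (cross-multiply p q 1 1 lt)

  ^-+ : ∀ t m n → t ^ (m ℕ.+ n) ≡ t ^ m * t ^ n
  ^-+ t zero    n = sym (*-identityˡ (t ^ n))
  ^-+ t (suc m) n = trans (cong (t *_) (^-+ t m n)) (sym (*-assoc t (t ^ m) (t ^ n)))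

  ^-* : ∀ t m n → (t ^ m) ^ n ≡ t ^ (m ℕ.* n)
  ^-* t m zero    rewrite ℕₚ.*-zeroʳ m = refl
  ^-* t m (suc n) rewrite ℕₚ.*-suc m n = trans (cong (t ^ m *_) (^-* t m n)) (sym (^-+ t m (m ℕ.* n)))

  *-pos : ∀ {a b} → 0ℚ < a → 0ℚ < b → 0ℚ < a * b
  *-pos {a} {b} a>0 b>0 = subst (_< a * b) (*-zeroˡ b) (*-monoˡ-<-pos b {{positive b>0}} a>0)

  ^-pos : ∀ {t} → 0ℚ < t → ∀ n → 0ℚ < t ^ n
  ^-pos t>0 zero    = ι-< {0} {1} ℕ.z<s
  ^-pos t>0 (suc n) = *-pos t>0 (^-pos t>0 n)

  ^-mono : ∀ {t} → 1ℚ ≤ t → ∀ {m n} → m ℕ.≤ n → t ^ m ≤ t ^ n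
  ^-mono 1≤t {n = zero}  ℕ.z≤n = ≤-refl
  ^-mono {t} 1≤t {m} {suc n} m≤1+n with ℕₚ.m≤n⇒m<n∨m≡n m≤1+n
  ... | inj₂ refl = ≤-refl
  ... | inj₁ m<1+n = begin
      t ^ m      ≤⟨ ^-mono 1≤t (ℕ.s≤s⁻¹ m<1+n) ⟩
      t ^ n      ≡⟨ *-identityˡ (t ^ n) ⟨
      1ℚ * t ^ n ≤⟨ *-monoʳ-≤-nonNeg (t ^ n) {{nonNegative (<⇒≤ (^-pos (<-≤-trans (ι-< {0} {1} ℕ.z<s) 1≤t) n))}} 1≤t ⟩
      t * t ^ n  ∎
    where open ≤-Reasoning

  /-^-cancel : ∀ p q .{{_ : ℕ.NonZero q}} j → (+ p / q) ^ j * ι (q ℕ.^ j) ≡ ι (p ℕ.^ j)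
  /-^-cancel p q zero    = *-identityˡ 1ℚ
  /-^-cancel p q (suc j) = begin
      α * α ^ j * ι (q ℕ.* q ℕ.^ j)     ≡⟨ cong (α * α ^ j *_) (ι-* q (q ℕ.^ j)) ⟩
      α * α ^ j * (ι q * ι (q ℕ.^ j))   ≡⟨ solve 4 (λ a b c d → a :* b :* (c :* d) := a :* c :* (b :* d)) refl α (α ^ j) (ι q) (ι (q ℕ.^ j)) ⟩
      α * ι q * (α ^ j * ι (q ℕ.^ j))   ≡⟨ cong₂ _*_ (/-*-cancel p q) (/-^-cancel p q j) ⟩
      ι p * ι (p ℕ.^ j)                 ≡⟨ ι-* p (p ℕ.^ j) ⟨
      ι (p ℕ.* p ℕ.^ j)                 ∎
    where
      open ≡-Reasoning
      α = + p / q

  ι-mix : ∀ p q .{{_ : ℕ.NonZero q}} {j n} → j ℕ.≤ n →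
          ι (p ℕ.^ j ℕ.* q ℕ.^ (n ℕ.∸ j)) ≡ ι (q ℕ.^ n) * (+ p / q) ^ j
  ι-mix p q {j} {n} j≤n = begin
      ι (p ℕ.^ j ℕ.* q ℕ.^ (n ℕ.∸ j))        ≡⟨ ι-* (p ℕ.^ j) _ ⟩
      ι (p ℕ.^ j) * ι (q ℕ.^ (n ℕ.∸ j))      ≡⟨ cong (_* ι (q ℕ.^ (n ℕ.∸ j))) (/-^-cancel p q j) ⟨
      α ^ j * ι (q ℕ.^ j) * ι (q ℕ.^ (n ℕ.∸ j)) ≡⟨ solve 3 (λ a b c → a :* b :* c := b :* c :* a) refl (α ^ j) (ι (q ℕ.^ j)) (ι (q ℕ.^ (n ℕ.∸ j))) ⟩
      ι (q ℕ.^ j) * ι (q ℕ.^ (n ℕ.∸ j)) * α ^ j ≡⟨ cong (_* α ^ j) (ι-* (q ℕ.^ j) _) ⟨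
      ι (q ℕ.^ j ℕ.* q ℕ.^ (n ℕ.∸ j)) * α ^ j  ≡⟨ cong (λ e → ι e * α ^ j) (ℕₚ.^-distribˡ-+-* q j (n ℕ.∸ j)) ⟨
      ι (q ℕ.^ (j ℕ.+ (n ℕ.∸ j))) * α ^ j     ≡⟨ cong (λ e → ι (q ℕ.^ e) * α ^ j) (ℕₚ.m+[n∸m]≡n j≤n) ⟩
      ι (q ℕ.^ n) * α ^ j                      ∎
    where
      open ≡-Reasoning
      α = + p / q

  ι-complement : ∀ p q .{{_ : ℕ.NonZero q}} {j n} a → j ℕ.≤ n →
                 a ℕ.+ p ℕ.^ j ℕ.* q ℕ.^ (n ℕ.∸ j) ≡ 2 ℕ.* q ℕ.^ n →
                 ι a ≡ ι (q ℕ.^ n) * (ι 2 - (+ p / q) ^ j)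
  ι-complement p q {j} {n} a j≤n sum≡ = begin
      ι a                      ≡⟨ solve 2 (λ a x → a := a :+ x :- x) refl (ι a) X ⟩
      ι a + X - X              ≡⟨ cong (_- X) total ⟩
      ι 2 * ι (q ℕ.^ n) - X    ≡⟨ solve 3 (λ t Q a → t :* Q :- Q :* a := Q :* (t :- a)) refl (ι 2) (ι (q ℕ.^ n)) (α ^ j) ⟩
      ι (q ℕ.^ n) * (ι 2 - α ^ j) ∎
    where
      open ≡-Reasoning
      α = + p / q
      X = ι (q ℕ.^ n) * α ^ j
      total : ι a + X ≡ ι 2 * ι (q ℕ.^ n)
      total = begin
        ι a + X                                   ≡⟨ cong (λ x → ι a + x) (ι-mix p q j≤n) ⟨
        ι a + ι (p ℕ.^ j ℕ.* q ℕ.^ (n ℕ.∸ j))     ≡⟨ ι-+ a _ ⟨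
        ι (a ℕ.+ p ℕ.^ j ℕ.* q ℕ.^ (n ℕ.∸ j))     ≡⟨ cong ι sum≡ ⟩
        ι (2 ℕ.* q ℕ.^ n)                         ≡⟨ ι-* 2 (q ℕ.^ n) ⟩
        ι 2 * ι (q ℕ.^ n)                         ∎

  ι-suc-* : ∀ k m → ι (suc k) * m ≡ m + ι k * m
  ι-suc-* k m rewrite ι-+ 1 k = solve 2 (λ a m → (con 1ℚ :+ a) :* m := m :+ a :* m) refl (ι k) m

  Σᶠ-≤ : ∀ k (f : Fin k → ℚ) m → (∀ j → f j ≤ m) → Σᶠ k f ≤ ι k * m
  Σᶠ-≤ zero    f m f≤m = ≤-reflexive (sym (*-zeroˡ m))
  Σᶠ-≤ (suc k) f m f≤m = begin
      f fzero + Σᶠ k (λ j → f (fsuc j)) ≤⟨ +-mono-≤ (f≤m fzero) (Σᶠ-≤ k (λ j → f (fsuc j)) m (λ j → f≤m (fsuc j))) ⟩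
      m + ι k * m                       ≡⟨ ι-suc-* k m ⟨
      ι (suc k) * m                     ∎
    where open ≤-Reasoning

  Σᶠ-≤-except : ∀ k (f : Fin k → ℚ) i m → 0ℚ ≤ m → (∀ j → j ≢ i → f j ≤ m) → Σᶠ k f ≤ f i + ι k * m
  Σᶠ-≤-except (suc k) f fzero m m≥0 f≤m = begin
      f fzero + Σᶠ k (λ j → f (fsuc j)) ≤⟨ +-monoʳ-≤ (f fzero) (Σᶠ-≤ k (λ j → f (fsuc j)) m (λ j → f≤m (fsuc j) (λ ()))) ⟩
      f fzero + ι k * m                 ≤⟨ +-monoʳ-≤ (f fzero) (subst (_≤ m + ι k * m) (+-identityˡ (ι k * m)) (+-monoˡ-≤ (ι k * m) m≥0)) ⟩
      f fzero + (m + ι k * m)           ≡⟨ cong (λ x → f fzero + x) (ι-suc-* k m) ⟨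
      f fzero + ι (suc k) * m           ∎
    where open ≤-Reasoning
  Σᶠ-≤-except (suc k) f (fsuc i) m m≥0 f≤m = begin
      f fzero + Σᶠ k (λ j → f (fsuc j))
        ≤⟨ +-mono-≤ (f≤m fzero (λ ())) (Σᶠ-≤-except k (λ j → f (fsuc j)) i m m≥0 (λ j j≢i → f≤m (fsuc j) (j≢i ∘ Finₚ.suc-injective))) ⟩
      m + (f (fsuc i) + ι k * m)  ≡⟨ solve 3 (λ m a b → m :+ (a :+ b) := a :+ (m :+ b)) refl m (f (fsuc i)) (ι k * m) ⟩
      f (fsuc i) + (m + ι k * m)  ≡⟨ cong (λ x → f (fsuc i) + x) (ι-suc-* k m) ⟨
      f (fsuc i) + ι (suc k) * m  ∎
    where open ≤-Reasoning

  term-on-curve : ∀ t P Q a b → term a b (t ^ P) (t ^ Q) ≡ t ^ (P ℕ.* a ℕ.+ Q ℕ.* b)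
  term-on-curve t P Q a b = trans (cong₂ _*_ (^-* t P a) (^-* t Q b)) (sym (^-+ t (P ℕ.* a) (Q ℕ.* b)))

  -- Suppose that for weights P > 0 and Q the weighted degree
  -- P·A i + Q·B i = e + 1 of the i-th term is positive and exceeds that of every other
  -- term.  If T_i ≤ c (S − T_i) held for x beyond n₁₀, then on x = t^P, y = t^Q with
  -- t = n₁₀ + c k + 1 we would get t·t^e = T_i ≤ c (S − T_i) ≤ c k t^e < t·t^e.
  dominant⇒independent : ∀ k (A B : Fin k → ℕ) i P Q → 0 ℕ.< P →
    0 ℕ.< P ℕ.* A i ℕ.+ Q ℕ.* B i →
    (∀ j → j ≢ i → P ℕ.* A j ℕ.+ Q ℕ.* B j ℕ.< P ℕ.* A i ℕ.+ Q ℕ.* B i) →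
    Independent k A B i
  dominant⇒independent k A B i P Q P>0 deg-pos dominant (c , n₁₀ , _ , c>0 , n₁₀>0 , _ , bigO) =
    <-irrefl refl (begin-strict
      t * t ^ e              ≡⟨ Tᵢ≡ ⟨
      Tᵢ                     ≤⟨ bigO x y (<⇒≤ (^-pos t>0 P)) (<⇒≤ (^-pos t>0 Q)) (inj₁ n₁₀≤x) ⟩
      c * (S - Tᵢ)           ≤⟨ *-monoˡ-≤-nonNeg c {{nonNegative (<⇒≤ c>0)}} rest≤ ⟩
      c * (ι k * t ^ e)      ≡⟨ *-assoc c (ι k) (t ^ e) ⟨
      c * ι k * t ^ e        <⟨ *-monoˡ-<-pos (t ^ e) {{positive (^-pos t>0 e)}} ck<t ⟩
      t * t ^ e              ∎)
    where
      open ≤-Reasoning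
      e : ℕ
      e = ℕ.pred (P ℕ.* A i ℕ.+ Q ℕ.* B i)
      ck≥0 : 0ℚ ≤ c * ι k
      ck≥0 = subst (_≤ c * ι k) (*-zeroʳ c) (*-monoˡ-≤-nonNeg c {{nonNegative (<⇒≤ c>0)}} (ι-≤ {0} {k} ℕ.z≤n))
      t : ℚ
      t = n₁₀ + c * ι k + 1ℚ
      1≤t : 1ℚ ≤ t
      1≤t = subst (_≤ t) (solve 0 (con 0ℚ :+ con 0ℚ :+ con 1ℚ := con 1ℚ) refl) (+-monoˡ-≤ 1ℚ (+-mono-≤ (<⇒≤ n₁₀>0) ck≥0))
      t>0 : 0ℚ < t
      t>0 = <-≤-trans (ι-< {0} {1} ℕ.z<s) 1≤t
      ck<t : c * ι k < t
      ck<t = subst (_< t) (solve 1 (λ a → con 0ℚ :+ a :+ con 0ℚ := a) refl (c * ι k))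
               (+-mono-≤-< (+-monoˡ-≤ (c * ι k) (<⇒≤ n₁₀>0)) (ι-< {0} {1} ℕ.z<s))
      x y : ℚ
      x = t ^ P
      y = t ^ Q
      n₁₀≤x : n₁₀ ≤ x
      n₁₀≤x = begin
        n₁₀                  ≡⟨ solve 1 (λ a → a :+ con 0ℚ :+ con 0ℚ := a) refl n₁₀ ⟨
        n₁₀ + 0ℚ + 0ℚ        ≤⟨ +-mono-≤ (+-monoʳ-≤ n₁₀ ck≥0) (ι-≤ {0} {1} ℕ.z≤n) ⟩
        t                    ≡⟨ *-identityʳ t ⟨
        t ^ 1                ≤⟨ ^-mono 1≤t P>0 ⟩
        x                    ∎
      S Tᵢ : ℚ
      S  = sumTerms k A B x y
      Tᵢ = term (A i) (B i) x y
      Tᵢ≡ : Tᵢ ≡ t * t ^ e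
      Tᵢ≡ = trans (term-on-curve t P Q (A i) (B i)) (cong (t ^_) (sym (ℕₚ.suc-pred _ {{ℕ.>-nonZero deg-pos}})))
      rest≤ : S - Tᵢ ≤ ι k * t ^ e
      rest≤ = subst (S - Tᵢ ≤_) (solve 2 (λ a b → a :+ b :- a := b) refl Tᵢ (ι k * t ^ e))
                (+-monoˡ-≤ (- Tᵢ) (Σᶠ-≤-except k (λ j → term (A j) (B j) x y) i (t ^ e) (<⇒≤ (^-pos t>0 e))
                  (λ j j≢i → subst (_≤ t ^ e) (sym (term-on-curve t P Q (A j) (B j))) (^-mono 1≤t (ℕₚ.<⇒≤pred (dominant j j≢i))))))

open import Defs
open import Data.Nat using (ℕ; NonZero; _∸_) renaming (_<_ to _<ℕ_; _^_ to _^ℕ_)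
open import Data.Fin using (Fin; toℕ)
open import Data.Integer using (+_)
open import Data.Rational using (ℚ; 0ℚ; 1ℚ; _+_; _-_; _*_; _<_; _/_)
open import Data.Product using (Σ; _×_; _,_)
open import Relation.Binary.PropositionalEquality using (_≡_)
open import Data.Rational.Properties using (<-trans)
open import Data.Fin.Properties using (toℕ≤pred[n]; toℕ-injective)
open import Function.Base using (_∘_)
open import Data.Nat using (suc) renaming (_≤_ to _≤ℕ_)

open Natural using (module Exponents)
open Rational using (/<1⇒<; cross-multiply; ι-mix; ι-complement; dominant⇒independent)

theorem2 : (k : ℕ) → 0 <ℕ k →
    (pα qα pβ qβ : ℕ) → .{{_ : NonZero qα}} → .{{_ : NonZero qβ}} →
    0 <ℕ pα → 0 <ℕ pβ →
    0ℚ < (+ pα / qα) → (+ pα / qα) < (+ pβ / qβ) →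
    (+ pβ / qβ) < 1ℚ - (+ pα / qα) → 1ℚ - (+ pα / qα) < 1ℚ →
    Σ (Fin k → ℕ) λ A → Σ (Fin k → ℕ) λ B →
      (∀ i → (0 <ℕ A i) × (0 <ℕ B i)
           × (ι (A i) ≡ ι (qα ^ℕ (k ∸ 1)) * ((ι 2 - (+ pα / qα) ^ toℕ i)))
           × (ι (B i) ≡ ι (qβ ^ℕ (k ∸ 1)) * ((+ pβ / qβ) ^ toℕ i)))
      × Irreducible k A B
theorem2 (suc n) _ pα qα pβ qβ pα>0 pβ>0 _ α<β β<1-α 1-α<1 =
  A , B ,
  (λ j → X.A-pos (≤n j) , X.B-pos (toℕ j)
       , ι-complement pα qα (A j) (≤n j) (X.A+D (≤n j)) , ι-mix pβ qβ (≤n j)) ,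
  (λ i → dominant⇒independent (suc n) A B i (X.P (toℕ i)) (X.Q (toℕ i)) (X.P-pos (toℕ i)) (X.deg-pos (≤n i))
           (λ j j≢i → X.deg-peak (≤n i) (toℕ j) (≤n j) (j≢i ∘ toℕ-injective)))
  where
    β<1 : + pβ / qβ < 1ℚ
    β<1 = <-trans β<1-α 1-α<1
    module X = Exponents pα qα pβ qβ pα>0 (/<1⇒< pα qα (<-trans α<β β<1)) pβ>0 (/<1⇒< pβ qβ β<1)
                         (cross-multiply pα qα pβ qβ α<β) n
    A B : Fin (suc n) → ℕ
    A j = X.A (toℕ j)
    B j = X.B (toℕ j)
    ≤n : (j : Fin (suc n)) → toℕ j ≤ℕ n
    ≤n = toℕ≤pred[n]
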